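{- Let $G$ be a graph with $n$ vertices and $S(G)=N$. Then $$|E(G)|\le\left(1-\frac{1}{\lceil N/2\rceil+1}\right)\frac{n^2}{2}.$$
   Context: For a finite simple graph $G=(V,E)$ and an injective map $f:V\to\mathbb Z$, let $\sigma(G,f)=\{f(v)+f(w): vw\in E\}$. The sum index of $G$ is $S(G)=\min_{f}|\sigma(G,f)|$ over all injective $f:V\to\mathbb Z$. -}

module Defs where

open import Data.Nat using (ℕ; _<_; _≤_; _*_; _+_; ⌈_/2⌉)
open import Data.Fin using (Fin; toℕ)
open import Data.Integer as ℤ using (ℤ)
import Data.Integer.Properties as ℤP
open import Data.List using (List; length; filter; cartesianProduct; allFin; map; deduplicate)
open import Data.Product using (_×_; _,_; proj₁; proj₂; Σ; ∃)
open import Relation.Nullary using (Dec; ¬_)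
open import Relation.Binary.PropositionalEquality using (_≡_)
open import Relation.Nullary.Decidable using (_×-dec_)
open import Function.Definitions using (Injective)
import Data.Nat.Properties as ℕP

record Graph (n : ℕ) : Set₁ where
  field
    Adj    : Fin n → Fin n → Set
    adj?   : (i j : Fin n) → Dec (Adj i j)
    sym    : ∀ {i j} → Adj i j → Adj j i
    irrefl : ∀ {i} → ¬ Adj i i

open Graph public

-- The edge set E(G): each edge {v,w} listed once, as the pair (v , w) with v < w.
edges : ∀ {n} → Graph n → List (Fin n × Fin n)
edges {n} G =
  filter (λ p → (toℕ (proj₁ p) ℕP.<? toℕ (proj₂ p)) ×-dec adj? G (proj₁ p) (proj₂ p))
         (cartesianProduct (allFin n) (allFin n))

numEdges : ∀ {n} → Graph n → ℕ
numEdges G = length (edges G)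

σ : ∀ {n} → Graph n → (Fin n → ℤ) → List ℤ
σ G f = deduplicate ℤ._≟_ (map (λ p → f (proj₁ p) ℤ.+ f (proj₂ p)) (edges G))

σsize : ∀ {n} → Graph n → (Fin n → ℤ) → ℕ
σsize G f = length (σ G f)

-- S(G) = N : the minimum of |σ(G,f)| over injective f : V → ℤ equals N
-- (attained by some injective f, and a lower bound for all injective f).
SumIndexIs : ∀ {n} → Graph n → ℕ → Set
SumIndexIs G N =
  (Σ (Fin _ → ℤ) λ f → Injective _≡_ _≡_ f × σsize G f ≡ N)
  × (∀ (f : Fin _ → ℤ) → Injective _≡_ _≡_ f → N ≤ σsize G f)

{-# OPTIONS --safe #-}
-- An injective f maps a clique on m vertices to integers c₀ < c₁ < … < c_{m-1}, and the sums
-- c₀+c₁ < c₀+c₂ < c₁+c₂ < c₁+c₃ < … < c_{m-2}+c_{m-1} are 2m − 3 distinct elements of σ(G,f).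
-- So every clique has at most ⌈N/2⌉ + 1 vertices, and Turán's theorem gives the bound.
-- Turán's inequality (k+1)·2e(L) ≤ k·|L|² for graphs without a clique on k + 2 vertices is
-- proved by induction: split L greedily into a maximal clique K and a rest R. Every vertex
-- of L has a non-neighbour in K, which bounds the edges meeting K; induction bounds those in R.
module Submission where

open import Defs
open import Data.Nat using (ℕ; suc; z≤n; s≤s; _+_; _*_; _≤_; _<_; ⌈_/2⌉)
import Data.Nat.Properties as ℕP
open import Data.Nat.Induction using (<-wellFounded)
open import Data.Nat.ListAction using (sum)
open import Data.Nat.ListAction.Properties using (sum-++; sum-↭)
open import Data.Nat.Tactic.RingSolver using (solve-∀)
open import Data.Integer as ℤ using (ℤ)
import Data.Integer.Properties as ℤP
open import Data.Fin using (Fin; toℕ)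
open import Data.Fin.Properties using (toℕ-injective)
open import Data.List using (List; []; _∷_; _++_; length; map; filter; cartesianProduct; allFin)
open import Data.List.Properties
  using (map-++; map-∘; map-cong; length-++; length-++-≤ʳ; length-filter; length-map; length-tabulate)
open import Data.List.Membership.Propositional using (_∈_)
open import Data.List.Membership.Propositional.Properties
  using (∈-deduplicate⁺; ∈-filter⁺; ∈-cartesianProduct⁺; ∈-allFin; ∈-map⁺)
open import Data.List.Relation.Unary.All as All using (All; []; _∷_; all?)
open import Data.List.Relation.Unary.All.Properties using (¬All⇒Any¬)
open import Data.List.Relation.Unary.Any as Any using (Any; here; there)
open import Data.List.Relation.Unary.AllPairs as AllPairs using (AllPairs; []; _∷_)
import Data.List.Relation.Unary.AllPairs.Properties as AllPairs
open import Data.List.Relation.Unary.Sorted.TotalOrder.Properties using (Sorted⇒AllPairs)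
open import Data.List.Relation.Binary.Permutation.Propositional
  using (_↭_; ↭-refl; ↭-sym; ↭-trans; ↭-prep; ↭⇒↭ₛ)
import Data.List.Relation.Binary.Permutation.Propositional.Properties as ↭
open import Data.List.Relation.Binary.Permutation.Setoid.Properties ℤP.≡-setoid using (AllPairs-resp-↭)
open import Data.List.Sort ℤP.≤-decTotalOrder using (sort; sort-↭; sort-↗)
open import Data.Product using (_×_; _,_; proj₁; proj₂)
open import Function using (_∘_; id)
open import Function.Definitions using (Injective)
open import Induction.WellFounded using (Acc; acc)
open import Level using (Level)
open import Relation.Binary.Definitions using (tri<; tri≈; tri>)
open import Relation.Binary.PropositionalEquality as ≡
  using (_≡_; _≢_; refl; cong; cong₂; subst; subst₂; resp₂; ≢-sym)
open import Relation.Nullary using (Dec; yes; no; ¬_; contradiction)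
open import Relation.Nullary.Decidable using (_×-dec_)
open import Relation.Unary using (Decidable)
open import Algebra.Properties.CommutativeSemigroup ℕP.+-commutativeSemigroup using (interchange; x∙yz≈y∙xz)

private variable
  ℓ₁ ℓ₂ : Level
  A B : Set ℓ₁

∑ : List A → (A → ℕ) → ℕ
∑ xs g = sum (map g xs)

syntax ∑ xs (λ x → e) = ∑[ x ∈ xs ] e

∑-cong : ∀ (xs : List A) {g h : A → ℕ} → (∀ x → g x ≡ h x) → ∑ xs g ≡ ∑ xs h
∑-cong xs g≗h = cong sum (map-cong g≗h xs)

∑-++ : ∀ (xs ys : List A) g → ∑ (xs ++ ys) g ≡ ∑ xs g + ∑ ys g
∑-++ xs ys g = ≡.trans (cong sum (map-++ g xs ys)) (sum-++ (map g xs) (map g ys))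

∑-map : ∀ (f : B → A) xs g → ∑ (map f xs) g ≡ ∑ xs (g ∘ f)
∑-map f xs g = cong sum (≡.sym (map-∘ xs))

∑-↭ : ∀ {xs ys : List A} g → xs ↭ ys → ∑ xs g ≡ ∑ ys g
∑-↭ g xs↭ys = sum-↭ (↭.map⁺ g xs↭ys)

∑-distrib-+ : ∀ (xs : List A) g h → ∑[ x ∈ xs ] (g x + h x) ≡ ∑ xs g + ∑ xs h
∑-distrib-+ [] g h = refl
∑-distrib-+ (x ∷ xs) g h =
  ≡.trans (cong (g x + h x +_) (∑-distrib-+ xs g h)) (interchange (g x) (h x) (∑ xs g) (∑ xs h))

∑-zero : ∀ (xs : List A) → ∑[ x ∈ xs ] 0 ≡ 0
∑-zero [] = refl
∑-zero (x ∷ xs) = ∑-zero xs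

∑-comm : ∀ (xs : List A) (ys : List B) (h : A → B → ℕ) →
  ∑[ x ∈ xs ] ∑[ y ∈ ys ] h x y ≡ ∑[ y ∈ ys ] ∑[ x ∈ xs ] h x y
∑-comm [] ys h = ≡.sym (∑-zero ys)
∑-comm (x ∷ xs) ys h = ≡.trans (cong (∑ ys (h x) +_) (∑-comm xs ys h))
  (≡.sym (∑-distrib-+ ys (h x) (λ y → ∑[ x ∈ xs ] h x y)))

∑-cartesianProduct : ∀ (xs : List A) (ys : List B) g →
  ∑ (cartesianProduct xs ys) g ≡ ∑[ x ∈ xs ] ∑[ y ∈ ys ] g (x , y)
∑-cartesianProduct [] ys g = refl
∑-cartesianProduct (x ∷ xs) ys g = ≡.trans (∑-++ (map (x ,_) ys) (cartesianProduct xs ys) g)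
  (cong₂ _+_ (∑-map (x ,_) ys g) (∑-cartesianProduct xs ys g))

∑-suc : ∀ (xs : List A) g → ∑[ x ∈ xs ] suc (g x) ≡ length xs + ∑ xs g
∑-suc [] g = refl
∑-suc (x ∷ xs) g = cong suc (≡.trans (cong (g x +_) (∑-suc xs g)) (x∙yz≈y∙xz (g x) (length xs) (∑ xs g)))

∑-≤ : ∀ {xs : List A} {g c} → All (λ x → g x ≤ c) xs → ∑ xs g ≤ length xs * c
∑-≤ [] = z≤n
∑-≤ (gx≤c ∷ g≤c) = ℕP.+-mono-≤ gx≤c (∑-≤ g≤c)

𝟙 : {P : Set ℓ₁} → Dec P → ℕ
𝟙 (yes _) = 1
𝟙 (no _)  = 0

length-filter-∑ : ∀ {P : A → Set ℓ₂} (P? : Decidable P) xs → length (filter P? xs) ≡ ∑[ x ∈ xs ] 𝟙 (P? x)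
length-filter-∑ P? [] = refl
length-filter-∑ P? (x ∷ xs) with P? x
... | yes _ = cong suc (length-filter-∑ P? xs)
... | no _  = length-filter-∑ P? xs

𝟙≤1 : {P : Set ℓ₁} (P? : Dec P) → 𝟙 P? ≤ 1
𝟙≤1 (yes _) = s≤s z≤n
𝟙≤1 (no _)  = z≤n

∑-𝟙-≤ : ∀ {P : A → Set ℓ₂} (P? : Decidable P) xs → ∑[ x ∈ xs ] 𝟙 (P? x) ≤ length xs
∑-𝟙-≤ P? [] = z≤n
∑-𝟙-≤ P? (x ∷ xs) = ℕP.+-mono-≤ (𝟙≤1 (P? x)) (∑-𝟙-≤ P? xs)

∑-𝟙-< : ∀ {P : A → Set ℓ₂} (P? : Decidable P) {xs} → Any (¬_ ∘ P) xs → ∑[ x ∈ xs ] 𝟙 (P? x) < length xs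
∑-𝟙-< P? {x ∷ xs} (here ¬Px) with P? x
... | yes Px = contradiction Px ¬Px
... | no _   = s≤s (∑-𝟙-≤ P? xs)
∑-𝟙-< P? {x ∷ xs} (there ¬P) with P? x
... | yes _ = s≤s (∑-𝟙-< P? ¬P)
... | no _  = ℕP.m≤n⇒m≤1+n (∑-𝟙-< P? ¬P)

count≥ : ℤ → List ℤ → ℕ
count≥ t U = length (filter (t ℤ.≤?_) U)

count≥-antitone : ∀ {s t} U → s ℤ.≤ t → count≥ t U ≤ count≥ s U
count≥-antitone [] s≤t = z≤n
count≥-antitone {s} {t} (u ∷ U) s≤t with s ℤ.≤? u | t ℤ.≤? u
... | yes _   | yes _   = s≤s (count≥-antitone U s≤t)
... | yes _   | no _    = ℕP.m≤n⇒m≤1+n (count≥-antitone U s≤t)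
... | no s≰u  | yes t≤u = contradiction (ℤP.≤-trans s≤t t≤u) s≰u
... | no _    | no _    = count≥-antitone U s≤t

count≥-skip : ∀ {s t x U} → x ∈ U → s ℤ.≤ x → x ℤ.< t → suc (count≥ t U) ≤ count≥ s U
count≥-skip {s} {t} {x} {u ∷ U} x∈U s≤x x<t with s ℤ.≤? u | t ℤ.≤? u | x∈U
... | no s≰u | _       | here refl = contradiction s≤x s≰u
... | no s≰u | yes t≤u | there _   = contradiction (ℤP.≤-trans (ℤP.<⇒≤ (ℤP.≤-<-trans s≤x x<t)) t≤u) s≰u
... | no _   | no _    | there x∈ = count≥-skip x∈ s≤x x<t
... | yes _  | yes t≤u | here refl = contradiction t≤u (ℤP.<⇒≱ x<t)
... | yes _  | no _    | here refl = s≤s (count≥-antitone U (ℤP.<⇒≤ (ℤP.≤-<-trans s≤x x<t)))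
... | yes _  | yes _   | there x∈ = s≤s (count≥-skip x∈ s≤x x<t)
... | yes _  | no _    | there x∈ = ℕP.m≤n⇒m≤1+n (count≥-skip x∈ s≤x x<t)

module _ (U : List ℤ) where

  DistinctSummands IncreasingSummands : ℤ → ℤ → Set
  DistinctSummands x y = x ≢ y × x ℤ.+ y ∈ U
  IncreasingSummands x y = x ℤ.< y × x ℤ.+ y ∈ U

  count≥-increasingSummands : ∀ {c₀ c₁} cs → AllPairs IncreasingSummands (c₀ ∷ c₁ ∷ cs) →
    suc (length cs + length cs) ≤ count≥ (c₀ ℤ.+ c₁) U
  count≥-increasingSummands [] (((_ , c₀+c₁∈U) ∷ []) ∷ _) =
    ℕP.≤-trans (s≤s z≤n) (count≥-skip c₀+c₁∈U ℤP.≤-refl (ℤP.suc[i]≤j⇒i<j ℤP.≤-refl))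
  count≥-increasingSummands {c₀} {c₁} (c₂ ∷ cs)
    (((c₀<c₁ , c₀+c₁∈U) ∷ (_ , c₀+c₂∈U) ∷ _) ∷ pairs@(((c₁<c₂ , _) ∷ _) ∷ _)) = begin
      suc (suc (length cs) + suc (length cs)) ≡⟨ cong (suc ∘ suc) (ℕP.+-suc _ _) ⟩
      suc (suc (suc (length cs + length cs))) ≤⟨ s≤s (s≤s (count≥-increasingSummands cs pairs)) ⟩
      suc (suc (count≥ (c₁ ℤ.+ c₂) U))        ≤⟨ s≤s (count≥-skip c₀+c₂∈U ℤP.≤-refl (ℤP.+-monoˡ-< c₂ c₀<c₁)) ⟩
      suc (count≥ (c₀ ℤ.+ c₂) U)              ≤⟨ count≥-skip c₀+c₁∈U ℤP.≤-refl (ℤP.+-monoʳ-< c₀ c₁<c₂) ⟩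
      count≥ (c₀ ℤ.+ c₁) U                    ∎
    where open ℕP.≤-Reasoning

  increasingSummands-length : ∀ cs → AllPairs IncreasingSummands cs → length cs + length cs ≤ 3 + length U
  increasingSummands-length [] _ = z≤n
  increasingSummands-length (_ ∷ []) _ = s≤s (s≤s z≤n)
  increasingSummands-length (c₀ ∷ c₁ ∷ cs) pairs = begin
    suc (suc (length cs)) + suc (suc (length cs)) ≡⟨ cong (suc ∘ suc) (ℕP.+-suc _ (suc (length cs))) ⟩
    suc (suc (suc (length cs + suc (length cs))))  ≡⟨ cong (3 +_) (ℕP.+-suc _ _) ⟩
    3 + suc (length cs + length cs)                ≤⟨ ℕP.+-monoʳ-≤ 3 (count≥-increasingSummands cs pairs) ⟩
    3 + count≥ (c₀ ℤ.+ c₁) U                       ≤⟨ ℕP.+-monoʳ-≤ 3 (length-filter _ U) ⟩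
    3 + length U                                   ∎
    where open ℕP.≤-Reasoning

  distinctSummands-length : ∀ W → AllPairs DistinctSummands W → length W + length W ≤ 3 + length U
  distinctSummands-length W pairs =
    subst (λ m → m + m ≤ 3 + length U) (↭.↭-length (sort-↭ W))
      (increasingSummands-length (sort W) (AllPairs.zipWith strict (sorted , distinct)))
    where
    strict : ∀ {x y} → x ℤ.≤ y × DistinctSummands x y → IncreasingSummands x y
    strict (x≤y , x≢y , x+y∈U) = ℤP.≤∧≢⇒< x≤y x≢y , x+y∈U
    sorted : AllPairs ℤ._≤_ (sort W)
    sorted = Sorted⇒AllPairs ℤP.≤-totalOrder (sort-↗ W)
    distinct : AllPairs DistinctSummands (sort W)
    distinct = AllPairs-resp-↭ DistinctSummands-sym (resp₂ DistinctSummands) (↭⇒↭ₛ (↭-sym (sort-↭ W))) pairs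
      where
      DistinctSummands-sym : ∀ {x y} → DistinctSummands x y → DistinctSummands y x
      DistinctSummands-sym {x} {y} (x≢y , x+y∈U) = ≢-sym x≢y , subst (_∈ U) (ℤP.+-comm x y) x+y∈U

  distinctSummands-length-≤-⌈/2⌉ : ∀ W → AllPairs DistinctSummands W → length W ≤ suc ⌈ length U /2⌉
  distinctSummands-length-≤-⌈/2⌉ W pairs =
    subst (_≤ _) (≡.sym (ℕP.n≡⌊n+n/2⌋ (length W))) (ℕP.⌊n/2⌋-mono (distinctSummands-length W pairs))

-- s = |K|, t = |R|, and a, b, c count the ordered adjacent pairs in K × K, R × K and R × R.
turán-arithmetic : ∀ {k s t a b c} → s ≤ suc k → s + a ≤ s * s → t + b ≤ t * s →
  suc k * c ≤ k * (t * t) → suc k * (a + (b + b) + c) ≤ k * ((s + t) * (s + t))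
turán-arithmetic {k} {s} {t} {a} {b} {c} s≤1+k KK RK RR = begin
  suc k * (X + c)           ≡⟨ ℕP.*-distribˡ-+ (suc k) X c ⟩
  suc k * X + suc k * c     ≤⟨ ℕP.+-mono-≤ (ℕP.+-cancelʳ-≤ (s * u) _ _ weighted) RR ⟩
  k * (s * u) + k * (t * t) ≡⟨ complete-square k s t ⟩
  k * ((s + t) * (s + t))   ∎
  where
  open ℕP.≤-Reasoning
  X u : ℕ
  X = a + (b + b)
  u = s + (t + t)

  X+u≤su : X + u ≤ s * u
  X+u≤su = begin
    X + u                              ≡⟨ regroup a b s t ⟩
    (s + a) + ((t + b) + (t + b))      ≤⟨ ℕP.+-mono-≤ KK (ℕP.+-mono-≤ RK RK) ⟩
    s * s + (t * s + t * s)            ≡⟨ factor s t ⟩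
    s * u                              ∎
    where
    regroup : ∀ a b s t → a + (b + b) + (s + (t + t)) ≡ (s + a) + ((t + b) + (t + b))
    regroup = solve-∀
    factor : ∀ s t → s * s + (t * s + t * s) ≡ s * (s + (t + t))
    factor = solve-∀

  weighted : suc k * X + s * u ≤ k * (s * u) + s * u
  weighted = begin
    suc k * X + s * u     ≤⟨ ℕP.+-monoʳ-≤ (suc k * X) (ℕP.*-monoˡ-≤ u s≤1+k) ⟩
    suc k * X + suc k * u ≡⟨ ℕP.*-distribˡ-+ (suc k) X u ⟨
    suc k * (X + u)       ≤⟨ ℕP.*-monoʳ-≤ (suc k) X+u≤su ⟩
    s * u + k * (s * u)   ≡⟨ ℕP.+-comm (s * u) _ ⟩
    k * (s * u) + s * u   ∎

  complete-square : ∀ k s t → k * (s * (s + (t + t))) + k * (t * t) ≡ k * ((s + t) * (s + t))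
  complete-square = solve-∀

module _ {n : ℕ} (G : Graph n) where

  Clique : List (Fin n) → Set
  Clique = AllPairs (Adj G)

  HasNonNeighbourIn : List (Fin n) → Fin n → Set
  HasNonNeighbourIn K x = Any (λ y → ¬ Adj G x y) K

  adj# : Fin n → Fin n → ℕ
  adj# x y = 𝟙 (adj? G x y)

  adjPairs : List (Fin n) → List (Fin n) → ℕ
  adjPairs A B = ∑[ x ∈ A ] ∑[ y ∈ B ] adj# x y

  adj#-sym : ∀ x y → adj# x y ≡ adj# y x
  adj#-sym x y with adj? G x y | adj? G y x
  ... | yes _   | yes _   = refl
  ... | no _    | no _    = refl
  ... | yes x~y | no y≁x  = contradiction (sym G x~y) y≁x
  ... | no x≁y  | yes y~x = contradiction (sym G y~x) x≁y

  adjPairs-comm : ∀ A B → adjPairs A B ≡ adjPairs B A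
  adjPairs-comm A B = ≡.trans (∑-comm A B adj#) (∑-cong B (λ y → ∑-cong A (λ x → adj#-sym x y)))

  adjPairs-++ˡ : ∀ A B C → adjPairs (A ++ B) C ≡ adjPairs A C + adjPairs B C
  adjPairs-++ˡ A B C = ∑-++ A B _

  adjPairs-++ʳ : ∀ A B C → adjPairs A (B ++ C) ≡ adjPairs A B + adjPairs A C
  adjPairs-++ʳ A B C = ≡.trans (∑-cong A (λ x → ∑-++ B C (adj# x))) (∑-distrib-+ A _ _)

  adjPairs-↭ : ∀ {A A′ B B′} → A ↭ A′ → B ↭ B′ → adjPairs A B ≡ adjPairs A′ B′
  adjPairs-↭ {A′ = A′} A↭A′ B↭B′ = ≡.trans (∑-↭ _ A↭A′) (∑-cong A′ (λ x → ∑-↭ (adj# x) B↭B′))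

  adjPairs-nonNeighbour-≤ : ∀ {A K} → All (HasNonNeighbourIn K) A →
    length A + adjPairs A K ≤ length A * length K
  adjPairs-nonNeighbour-≤ {A} {K} nonAdj = begin
    length A + adjPairs A K               ≡⟨ ∑-suc A _ ⟨
    ∑[ x ∈ A ] suc (∑[ y ∈ K ] adj# x y) ≤⟨ ∑-≤ (All.map (∑-𝟙-< (adj? G _)) nonAdj) ⟩
    length A * length K                   ∎
    where open ℕP.≤-Reasoning

  nonNeighbour-self : ∀ K → All (HasNonNeighbourIn K) K
  nonNeighbour-self K = All.tabulate (Any.map (λ { refl → irrefl G }))

  TuránBound : ℕ → List (Fin n) → Set
  TuránBound k L = suc k * adjPairs L L ≤ k * (length L * length L)

  TuránBound-↭ : ∀ k {L L′} → L ↭ L′ → TuránBound k L′ → TuránBound k L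
  TuránBound-↭ k L↭L′ = subst₂ (λ p l → suc k * p ≤ k * (l * l))
    (≡.sym (adjPairs-↭ L↭L′ L↭L′)) (≡.sym (↭.↭-length L↭L′))

  turán-step : ∀ k K R → length K ≤ suc k → All (HasNonNeighbourIn K) R →
    TuránBound k R → TuránBound k (K ++ R)
  turán-step k K R s≤1+k nonAdj bound = begin
    suc k * adjPairs (K ++ R) (K ++ R)                  ≡⟨ cong (suc k *_) decomposition ⟩
    suc k * (a + (b + b) + c)                           ≤⟨ turán-arithmetic s≤1+k
                                                             (adjPairs-nonNeighbour-≤ (nonNeighbour-self K))
                                                             (adjPairs-nonNeighbour-≤ nonAdj) bound ⟩
    k * ((length K + length R) * (length K + length R)) ≡⟨ cong (λ l → k * (l * l)) (length-++ K) ⟨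
    k * (length (K ++ R) * length (K ++ R))             ∎
    where
    open ℕP.≤-Reasoning
    a b c : ℕ
    a = adjPairs K K
    b = adjPairs R K
    c = adjPairs R R

    decomposition : adjPairs (K ++ R) (K ++ R) ≡ a + (b + b) + c
    decomposition = begin-equality
      adjPairs (K ++ R) (K ++ R)                ≡⟨ adjPairs-++ˡ K R (K ++ R) ⟩
      adjPairs K (K ++ R) + adjPairs R (K ++ R) ≡⟨ cong₂ _+_ (adjPairs-++ʳ K K R) (adjPairs-++ʳ R K R) ⟩
      (a + adjPairs K R) + (b + c)              ≡⟨ cong (λ m → (a + m) + (b + c)) (adjPairs-comm K R) ⟩
      (a + b) + (b + c)                         ≡⟨ regroup a b c ⟩
      a + (b + b) + c                           ∎
      where
      regroup : ∀ a b c → (a + b) + (b + c) ≡ a + (b + b) + c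
      regroup = solve-∀

  record CliqueSplit (L : List (Fin n)) : Set where
    field
      clique rest : List (Fin n)
      partition   : L ↭ clique ++ rest
      isClique    : Clique clique
      isMaximal   : All (HasNonNeighbourIn clique) rest

  cliqueSplit : ∀ L → CliqueSplit L
  cliqueSplit []       = record
    { clique = [] ; rest = [] ; partition = ↭-refl ; isClique = [] ; isMaximal = [] }
  cliqueSplit (x ∷ xs) = extend (cliqueSplit xs)
    where
    -- The clique only grows as vertices are added, so a rejected vertex keeps its non-neighbour.
    extend : CliqueSplit xs → CliqueSplit (x ∷ xs)
    extend record { clique = K ; rest = R ; partition = p ; isClique = c ; isMaximal = m }
      with all? (adj? G x) K
    ... | yes x~K = record
      { clique = x ∷ K ; rest = R ; partition = ↭-prep x p
      ; isClique = x~K ∷ c ; isMaximal = All.map there m }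
    ... | no x≁K = record
      { clique = K ; rest = x ∷ R ; partition = ↭-trans (↭-prep x p) (↭-sym (↭.shift x K R))
      ; isClique = c ; isMaximal = ¬All⇒Any¬ (adj? G x) K x≁K ∷ m }

  turán : ∀ k → (∀ K → Clique K → length K ≤ suc k) → ∀ L → TuránBound k L
  turán k ω≤1+k L = go L (<-wellFounded (length L))
    where
    go : ∀ L → Acc _<_ (length L) → TuránBound k L
    go L (acc smaller) with cliqueSplit L
    ... | record { clique = [] ; rest = [] ; partition = p } = TuránBound-↭ k p ℕP.≤-refl
    ... | record { clique = [] ; rest = _ ∷ _ ; isMaximal = () ∷ _ }
    ... | record { clique = K@(_ ∷ K′) ; rest = R ; partition = p ; isClique = c ; isMaximal = m } =
      TuránBound-↭ k p (turán-step k K R (ω≤1+k K c) m (go R (smaller R<L)))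
      where
      R<L : length R < length L
      R<L = ℕP.≤-trans (s≤s (length-++-≤ʳ R {K′})) (ℕP.≤-reflexive (≡.sym (↭.↭-length p)))

  edge? : (p : Fin n × Fin n) → Dec (toℕ (proj₁ p) < toℕ (proj₂ p) × Adj G (proj₁ p) (proj₂ p))
  edge? (i , j) = (toℕ i ℕP.<? toℕ j) ×-dec adj? G i j

  numEdges-∑ : numEdges G ≡ ∑[ i ∈ allFin n ] ∑[ j ∈ allFin n ] 𝟙 (edge? (i , j))
  numEdges-∑ = ≡.trans (length-filter-∑ edge? (cartesianProduct (allFin n) (allFin n)))
    (∑-cartesianProduct (allFin n) (allFin n) (𝟙 ∘ edge?))

  adj#-split : ∀ i j → adj# i j ≡ 𝟙 (edge? (i , j)) + 𝟙 (edge? (j , i))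
  adj#-split i j with toℕ i ℕP.<? toℕ j | toℕ j ℕP.<? toℕ i | adj? G i j | adj? G j i
  ... | _       | _       | yes i~j | no j≁i  = contradiction (sym G i~j) j≁i
  ... | _       | _       | no i≁j  | yes j~i = contradiction (sym G j~i) i≁j
  ... | yes i<j | yes j<i | _       | _       = contradiction j<i (ℕP.<⇒≯ i<j)
  ... | no i≮j  | no j≮i  | yes i~j | yes _   = contradiction (subst (Adj G i) (≡.sym i≡j) i~j) (irrefl G)
    where
    i≡j : i ≡ j
    i≡j = toℕ-injective (ℕP.≤-antisym (ℕP.≮⇒≥ j≮i) (ℕP.≮⇒≥ i≮j))
  ... | no _    | no _    | no _    | no _    = refl
  ... | yes _   | no _    | yes _   | yes _   = refl
  ... | yes _   | no _    | no _    | no _    = refl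
  ... | no _    | yes _   | yes _   | yes _   = refl
  ... | no _    | yes _   | no _    | no _    = refl

  adjPairs-allFin : adjPairs (allFin n) (allFin n) ≡ numEdges G + numEdges G
  adjPairs-allFin = begin
    adjPairs V V                                      ≡⟨ ∑-cong V (λ i → ∑-cong V (adj#-split i)) ⟩
    ∑[ i ∈ V ] ∑[ j ∈ V ] (e i j + e j i)             ≡⟨ ∑-cong V (λ i → ∑-distrib-+ V (e i) (λ j → e j i)) ⟩
    ∑[ i ∈ V ] (∑[ j ∈ V ] e i j + ∑[ j ∈ V ] e j i)  ≡⟨ ∑-distrib-+ V _ _ ⟩
    E + ∑[ i ∈ V ] ∑[ j ∈ V ] e j i                   ≡⟨ cong (E +_) (∑-comm V V (λ i j → e j i)) ⟩
    E + E                                             ≡⟨ cong₂ _+_ numEdges-∑ numEdges-∑ ⟨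
    numEdges G + numEdges G                           ∎
    where
    open ≡.≡-Reasoning
    V : List (Fin n)
    V = allFin n
    e : Fin n → Fin n → ℕ
    e i j = 𝟙 (edge? (i , j))
    E : ℕ
    E = ∑[ i ∈ V ] ∑[ j ∈ V ] e i j

  ∈-edges : ∀ {v w} → toℕ v < toℕ w → Adj G v w → (v , w) ∈ edges G
  ∈-edges {v} {w} v<w v~w = ∈-filter⁺ edge? (∈-cartesianProduct⁺ (∈-allFin v) (∈-allFin w)) (v<w , v~w)

  module _ (f : Fin n → ℤ) where

    ∈-edges⇒sum∈σ : ∀ {v w} → (v , w) ∈ edges G → f v ℤ.+ f w ∈ σ G f
    ∈-edges⇒sum∈σ vw∈E = ∈-deduplicate⁺ ℤ._≟_ (∈-map⁺ (λ p → f (proj₁ p) ℤ.+ f (proj₂ p)) vw∈E)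

    adj⇒sum∈σ : ∀ {v w} → Adj G v w → f v ℤ.+ f w ∈ σ G f
    adj⇒sum∈σ {v} {w} v~w with ℕP.<-cmp (toℕ v) (toℕ w)
    ... | tri< v<w _ _ = ∈-edges⇒sum∈σ (∈-edges v<w v~w)
    ... | tri> _ _ w<v = subst (_∈ σ G f) (ℤP.+-comm (f w) (f v)) (∈-edges⇒sum∈σ (∈-edges w<v (sym G v~w)))
    ... | tri≈ _ v≡w _ = contradiction (subst (Adj G v) (≡.sym (toℕ-injective v≡w)) v~w) (irrefl G)

    clique-length-≤ : Injective _≡_ _≡_ f → ∀ {K} → Clique K → length K ≤ suc ⌈ σsize G f /2⌉
    clique-length-≤ f-injective {K} K-clique = subst (_≤ suc ⌈ σsize G f /2⌉) (length-map f K)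
      (distinctSummands-length-≤-⌈/2⌉ (σ G f) (map f K) (AllPairs.map⁺ (AllPairs.map distinct K-clique)))
      where
      distinct : ∀ {v w} → Adj G v w → DistinctSummands (σ G f) (f v) (f w)
      distinct {v} v~w =
        (λ fv≡fw → irrefl G (subst (Adj G v) (≡.sym (f-injective fv≡fw)) v~w)) , adj⇒sum∈σ v~w

proposition3p3 : (n : ℕ) (G : Graph n) (N : ℕ) → SumIndexIs G N →
    2 * (⌈ N /2⌉ + 1) * numEdges G ≤ ⌈ N /2⌉ * (n * n)
proposition3p3 n G N ((f , f-injective , |σ|≡N) , _) = begin
  2 * (k + 1) * numEdges G                    ≡⟨ double k (numEdges G) ⟩
  suc k * (numEdges G + numEdges G)           ≡⟨ cong (suc k *_) (adjPairs-allFin G) ⟨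
  suc k * adjPairs G (allFin n) (allFin n)    ≤⟨ turán G k cliques-small (allFin n) ⟩
  k * (length (allFin n) * length (allFin n)) ≡⟨ cong (λ l → k * (l * l)) (length-tabulate {n = n} id) ⟩
  k * (n * n)                                 ∎
  where
  open ℕP.≤-Reasoning
  k : ℕ
  k = ⌈ N /2⌉
  double : ∀ m e → 2 * (m + 1) * e ≡ suc m * (e + e)
  double = solve-∀
  cliques-small : ∀ K → Clique G K → length K ≤ suc k
  cliques-small K K-clique =
    subst (λ m → length K ≤ suc ⌈ m /2⌉) |σ|≡N (clique-length-≤ G f f-injective K-clique)
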